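{- For generalized wheel graphs with $n \geq 4$, $\mathrm{nim}(\mathrm{GEN}(W_{m,n}))=0$.
   Context: For $m\ge 2$ and $n\ge 3$, the generalized wheel graph $W_{m,n}$ is the join $\overline{K}_m+C_n$ of an edgeless graph on $m$ vertices with a cycle on $n$ vertices. For a graph $G=(V,E)$, a set of vertices is geodetically convex if it contains every vertex on every shortest path between two of its vertices; the convex hull $[P]$ is the smallest convex set containing $P$, and $P$ is generating if $[P]=V$. In the achievement game $\mathrm{GEN}(G)$, two players alternately select previously-unselected vertices; the game ends as soon as the selected set generates, and the last player to move wins. $\mathrm{nim}$ denotes the nim-number of an impartial game. -}

module Defs where

open import Data.Nat using (ℕ; zero; suc; _+_; _≤_; _<_)
open import Data.Fin using (Fin; toℕ; splitAt)
open import Data.Fin.Subset using (Subset; _∈_; _∉_; _⊆_; _∪_; ⁅_⁆; ⊥)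
open import Data.Sum using (_⊎_; inj₁; inj₂)
open import Data.Product using (_×_; ∃; ∃-syntax)
open import Data.Unit using (⊤)
open import Data.Empty renaming (⊥ to Empty)
open import Relation.Nullary using (¬_)
open import Relation.Binary.PropositionalEquality using (_≡_; _≢_)

record Graph (N : ℕ) : Set₁ where
  field
    Adj : Fin N → Fin N → Set
open Graph public

module _ {N : ℕ} (G : Graph N) where

  data Walk : Fin N → Fin N → ℕ → Set where
    here : ∀ {u} → Walk u u 0
    step : ∀ {u w v k} → Adj G u w → Walk w v k → Walk u v (suc k)

  -- w lies on some shortest u–v path: a u–w walk followed by a w–v walk
  -- whose total length is at most the length of every u–v walk.
  OnShortest : Fin N → Fin N → Fin N → Set
  OnShortest u w v =
    ∃[ a ] ∃[ b ] (Walk u w a × Walk w v b × (∀ k → Walk u v k → a + b ≤ k))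

  Convex : Subset N → Set
  Convex S = ∀ u v w → u ∈ S → v ∈ S → OnShortest u w v → w ∈ S

  InHull : Subset N → Fin N → Set
  InHull P x = ∀ S → Convex S → P ⊆ S → x ∈ S

  Generating : Subset N → Set
  Generating P = ∀ x → InHull P x

  -- NimF f P k : "the position P (set of selected vertices) of GEN(G) has
  -- nim-number k", computed with recursion fuel f.  A finished position
  -- (P generating) has no options, so nim-number 0; otherwise the
  -- nim-number is the mex of the nim-numbers of the options P ∪ {v}, v ∉ P.
  NimF : ℕ → Subset N → ℕ → Set
  NimF zero    P k = Empty
  NimF (suc f) P k =
      (Generating P × k ≡ 0)
    ⊎ (¬ Generating P
       × (∀ v → v ∉ P → ∀ j → NimF f (P ∪ ⁅ v ⁆) j → j ≢ k)
       × (∀ j → j < k → ∃[ v ] (v ∉ P × NimF f (P ∪ ⁅ v ⁆) j)))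

  -- nim(GEN(G)) = k.  Fuel suc N suffices: every move selects a new vertex,
  -- so at most N moves are ever made.
  NimGEN : ℕ → Set
  NimGEN k = NimF (suc N) ⊥ k

CycleAdj : (n : ℕ) → Fin n → Fin n → Set
CycleAdj n i j =
    suc (toℕ i) ≡ toℕ j
  ⊎ suc (toℕ j) ≡ toℕ i
  ⊎ (toℕ i ≡ 0 × suc (toℕ j) ≡ n)
  ⊎ (toℕ j ≡ 0 × suc (toℕ i) ≡ n)

-- Generalized wheel W_{m,n} = complement(K_m) + C_n on Fin (m + n):
-- the first m vertices form the independent set, the last n the cycle.
WheelAdj : (m n : ℕ) → Fin (m + n) → Fin (m + n) → Set
WheelAdj m n x y with splitAt m x | splitAt m y
... | inj₁ _ | inj₁ _ = Empty
... | inj₁ _ | inj₂ _ = ⊤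
... | inj₂ _ | inj₁ _ = ⊤
... | inj₂ i | inj₂ j = CycleAdj n i j

Wheel : (m n : ℕ) → Graph (m + n)
Wheel m n = record { Adj = WheelAdj m n }

{-# OPTIONS --safe #-}
-- The second player wins with their first move.  A single vertex is a convex set, so
-- the first move never generates; but every vertex v of W_{m,n} has a partner w with
-- [v, w] = V.  Two distinct hubs have the whole rim as common neighbours, and every
-- hub is a common neighbour of the rim vertices 0 and 2; two rim vertices at cycle
-- distance 2 have all hubs as common neighbours, and they are non-adjacent exactly
-- because n ≥ 4.  So every option of the empty position has nim-number ≠ 0.
module Submission where

open import Defs
open import Data.Nat using (ℕ; zero; suc; _+_; _≤_; z≤n; s≤s)
open import Data.Nat.Properties using (0≢1+n; 1+n≢n; m≢1+n+m)
open import Data.Fin using (Fin; toℕ; splitAt; _↑ˡ_; _↑ʳ_; inject₁)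
  renaming (zero to fz; suc to fs)
open import Data.Fin.Properties
  using (splitAt-↑ˡ; splitAt-↑ʳ; splitAt⁻¹-↑ˡ; splitAt⁻¹-↑ʳ; ↑ˡ-injective; ↑ʳ-injective; toℕ-inject₁)
open import Data.Fin.Subset using (_∈_; _∉_; _⊆_; _∪_; ⁅_⁆; ⊥)
open import Data.Fin.Subset.Properties
  using (∉⊥; x∈⁅x⁆; x∈⁅y⁆⇒x≡y; p⊆p∪q; q⊆p∪q; ⊆-reflexive; ∪-identityˡ)
open import Data.Sum using (inj₁; inj₂)
open import Data.Product using (_×_; _,_; ∃-syntax)
open import Data.Unit using (tt)
open import Data.Empty using (⊥-elim)
open import Function using (_∘_)
open import Relation.Nullary using (¬_)
open import Relation.Binary.PropositionalEquality using (_≡_; _≢_; refl; sym; trans; cong; subst)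

module _ {N : ℕ} (G : Graph N) where

  nonadjacent-walk-length : ∀ {u v k} → u ≢ v → ¬ Adj G u v → Walk G u v k → 2 ≤ k
  nonadjacent-walk-length u≢v _  here                = ⊥-elim (u≢v refl)
  nonadjacent-walk-length _   ¬a (step a here)       = ⊥-elim (¬a a)
  nonadjacent-walk-length _   _  (step _ (step _ _)) = s≤s (s≤s z≤n)

  convex-commonNeighbour : ∀ {S u v w} → Convex G S → u ∈ S → v ∈ S →
                           u ≢ v → ¬ Adj G u v → Adj G u w → Adj G w v → w ∈ S
  convex-commonNeighbour {w = w} conv u∈S v∈S u≢v ¬uv uw wv =
    conv _ _ w u∈S v∈S
      (1 , 1 , step uw here , step wv here , λ _ → nonadjacent-walk-length u≢v ¬uv)

  ⁅⁆-convex : ∀ v → Convex G ⁅ v ⁆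
  ⁅⁆-convex v u v′ w u∈ v′∈ (a , b , u⇝w , _ , shortest)
    with refl ← x∈⁅y⁆⇒x≡y v u∈ | refl ← x∈⁅y⁆⇒x≡y v v′∈
    with a | u⇝w | shortest 0 here
  ... | zero  | here | _  = u∈
  ... | suc _ | _    | ()

  ⊆⁅⁆⇒¬Generating : ∀ {P v w} → P ⊆ ⁅ v ⁆ → w ≢ v → ¬ Generating G P
  ⊆⁅⁆⇒¬Generating {v = v} {w} P⊆⁅v⁆ w≢v gen =
    w≢v (x∈⁅y⁆⇒x≡y v (gen w ⁅ v ⁆ (⁅⁆-convex v) P⊆⁅v⁆))

  PairGenerates : Fin N → Fin N → Set
  PairGenerates u v = ∀ S → Convex G S → u ∈ S → v ∈ S → ∀ x → x ∈ S

  PairGenerates-sym : ∀ {u v} → PairGenerates u v → PairGenerates v u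
  PairGenerates-sym gen S conv v∈S u∈S = gen S conv u∈S v∈S

  PairGenerates⇒Generating : ∀ {u v P} → PairGenerates u v → u ∈ P → v ∈ P → Generating G P
  PairGenerates⇒Generating gen u∈P v∈P x S conv P⊆S = gen S conv (P⊆S u∈P) (P⊆S v∈P) x

  generating⇒nim0 : ∀ f {P} → Generating G P → NimF G (suc f) P 0
  generating⇒nim0 f gen = inj₁ (gen , refl)

  generatingReply⇒nim≢0 : ∀ f {Q w j} → ¬ Generating G Q → w ∉ Q → Generating G (Q ∪ ⁅ w ⁆) →
                           NimF G (suc (suc f)) Q j → j ≢ 0
  generatingReply⇒nim≢0 f ¬gen _ _ (inj₁ (gen , _)) _ = ¬gen gen
  generatingReply⇒nim≢0 f {w = w} _ w∉Q gen (inj₂ (_ , options≢ , _)) j≡0 =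
    options≢ w w∉Q 0 (generating⇒nim0 f gen) (sym j≡0)

pairing⇒NimGEN-zero : ∀ {N} (G : Graph (suc (suc N))) →
                      (∀ v → ∃[ w ] (w ≢ v × PairGenerates G v w)) → NimGEN G 0
pairing⇒NimGEN-zero {N} G partner = inj₂ (¬Generating-⊥ , answered , λ _ ())
  where
  ¬Generating-⊥ : ¬ Generating G ⊥
  ¬Generating-⊥ with partner fz
  ... | _ , w≢0 , _ = ⊆⁅⁆⇒¬Generating G (⊥-elim ∘ ∉⊥) w≢0

  answered : ∀ v → v ∉ ⊥ → ∀ j → NimF G (suc (suc N)) (⊥ ∪ ⁅ v ⁆) j → j ≢ 0
  answered v _ j with partner v
  ... | w , w≢v , gen =
    generatingReply⇒nim≢0 G N
      (⊆⁅⁆⇒¬Generating G ⊥∪⁅v⁆⊆⁅v⁆ w≢v)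
      (w≢v ∘ x∈⁅y⁆⇒x≡y v ∘ ⊥∪⁅v⁆⊆⁅v⁆)
      (PairGenerates⇒Generating G gen
        (p⊆p∪q ⁅ w ⁆ (q⊆p∪q ⊥ ⁅ v ⁆ (x∈⁅x⁆ v)))
        (q⊆p∪q _ ⁅ w ⁆ (x∈⁅x⁆ w)))
    where
    ⊥∪⁅v⁆⊆⁅v⁆ : ⊥ ∪ ⁅ v ⁆ ⊆ ⁅ v ⁆
    ⊥∪⁅v⁆⊆⁅v⁆ = ⊆-reflexive (∪-identityˡ ⁅ v ⁆)

module WheelGraph (m′ n′ : ℕ) where

  private
    m = 2 + m′
    n = 4 + n′
    W = Wheel m n

  hub : Fin m → Fin (m + n)
  hub i = i ↑ˡ n

  rim : Fin n → Fin (m + n)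
  rim j = m ↑ʳ j

  data HubOrRim : Fin (m + n) → Set where
    isHub : ∀ i → HubOrRim (hub i)
    isRim : ∀ j → HubOrRim (rim j)

  hubOrRim : ∀ x → HubOrRim x
  hubOrRim x with splitAt m x in eq
  ... | inj₁ i = subst HubOrRim (splitAt⁻¹-↑ˡ eq) (isHub i)
  ... | inj₂ j = subst HubOrRim (splitAt⁻¹-↑ʳ eq) (isRim j)

  hub-rim-adjacent : ∀ i j → Adj W (hub i) (rim j)
  hub-rim-adjacent i j rewrite splitAt-↑ˡ m i n | splitAt-↑ʳ m n j = tt

  rim-hub-adjacent : ∀ j i → Adj W (rim j) (hub i)
  rim-hub-adjacent j i rewrite splitAt-↑ˡ m i n | splitAt-↑ʳ m n j = tt

  hub-hub-nonadjacent : ∀ i i′ → ¬ Adj W (hub i) (hub i′)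
  hub-hub-nonadjacent i i′ rewrite splitAt-↑ˡ m i n | splitAt-↑ˡ m i′ n = λ ()

  rim-rim-adjacent⇒cycle : ∀ a b → Adj W (rim a) (rim b) → CycleAdj n a b
  rim-rim-adjacent⇒cycle a b rewrite splitAt-↑ʳ m n a | splitAt-↑ʳ m n b = λ adj → adj

  rim-skip-nonadjacent : ∀ a b → toℕ a ≡ 2 + toℕ b → ¬ Adj W (rim a) (rim b)
  rim-skip-nonadjacent a b a≡b+2 adj with rim-rim-adjacent⇒cycle a b adj
  ... | inj₁ a+1≡b = m≢1+n+m (toℕ b) (trans (sym a+1≡b) (cong suc a≡b+2))
  ... | inj₂ (inj₁ b+1≡a) = 1+n≢n (sym (trans b+1≡a a≡b+2))
  ... | inj₂ (inj₂ (inj₁ (a≡0 , _))) = 0≢1+n (trans (sym a≡0) a≡b+2)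
  ... | inj₂ (inj₂ (inj₂ (b≡0 , a+1≡n)))
    with trans (sym (cong suc (trans a≡b+2 (cong (2 +_) b≡0)))) a+1≡n
  ... | ()

  rim-skip-distinct : ∀ a b → toℕ a ≡ 2 + toℕ b → rim a ≢ rim b
  rim-skip-distinct a b a≡b+2 ra≡rb with refl ← ↑ʳ-injective m a b ra≡rb =
    m≢1+n+m (toℕ a) a≡b+2

  distinct-hubs-generate : ∀ {i i′} → i ≢ i′ → PairGenerates W (hub i) (hub i′)
  distinct-hubs-generate {i} {i′} i≢i′ S conv hi∈S hi′∈S x = ∈S (hubOrRim x)
    where
    rim∈S : ∀ j → rim j ∈ S
    rim∈S j = convex-commonNeighbour W conv hi∈S hi′∈S
      (λ hi≡hi′ → i≢i′ (↑ˡ-injective n i i′ hi≡hi′)) (hub-hub-nonadjacent i i′)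
      (hub-rim-adjacent i j) (rim-hub-adjacent j i′)

    ∈S : ∀ {x} → HubOrRim x → x ∈ S
    ∈S (isRim j) = rim∈S j
    ∈S (isHub k) = convex-commonNeighbour W conv (rim∈S (fs (fs fz))) (rim∈S fz)
      (rim-skip-distinct _ _ refl) (rim-skip-nonadjacent _ _ refl)
      (rim-hub-adjacent _ k) (hub-rim-adjacent k _)

  rim-skip-generates : ∀ a b → toℕ a ≡ 2 + toℕ b → PairGenerates W (rim a) (rim b)
  rim-skip-generates a b a≡b+2 S conv ra∈S rb∈S =
    distinct-hubs-generate {fz} {fs fz} (λ ()) S conv (hub∈S fz) (hub∈S (fs fz))
    where
    hub∈S : ∀ i → hub i ∈ S
    hub∈S i = convex-commonNeighbour W conv ra∈S rb∈S
      (rim-skip-distinct a b a≡b+2) (rim-skip-nonadjacent a b a≡b+2)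
      (rim-hub-adjacent a i) (hub-rim-adjacent i b)

  partner : ∀ v → ∃[ w ] (w ≢ v × PairGenerates W v w)
  partner v with hubOrRim v
  ... | isHub fz     = hub (fs fz) , (λ ()) ∘ ↑ˡ-injective n (fs fz) fz ,
                       distinct-hubs-generate (λ ())
  ... | isHub (fs i) = hub fz , (λ ()) ∘ ↑ˡ-injective n fz (fs i) ,
                       distinct-hubs-generate (λ ())
  ... | isRim fz          = rim (fs (fs fz)) , rim-skip-distinct _ _ refl ,
                            PairGenerates-sym W (rim-skip-generates _ _ refl)
  ... | isRim (fs fz)     = rim (fs (fs (fs fz))) , rim-skip-distinct _ _ refl ,
                            PairGenerates-sym W (rim-skip-generates _ _ refl)
  ... | isRim (fs (fs j)) = rim j₋₂ , (λ r≡ → rim-skip-distinct _ _ skip (sym r≡)) ,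
                            rim-skip-generates _ _ skip
    where
    j₋₂ : Fin n
    j₋₂ = inject₁ (inject₁ j)
    skip : toℕ (fs (fs j)) ≡ 2 + toℕ j₋₂
    skip = cong (2 +_) (sym (trans (toℕ-inject₁ (inject₁ j)) (toℕ-inject₁ j)))

proposition7p29 : ∀ m n → 2 ≤ m → 4 ≤ n → NimGEN (Wheel m n) 0
proposition7p29 (suc (suc m′)) (suc (suc (suc (suc n′)))) (s≤s (s≤s _)) (s≤s (s≤s (s≤s (s≤s _)))) =
  pairing⇒NimGEN-zero _ (WheelGraph.partner m′ n′)
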